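{- Let $u$ be a rational number with $u\neq0,\pm1,\pm3$, and let $r=\frac{2u}{3-u^2}$, $s=\frac{8u^2}{u^4-9}$. Define $$a=-\frac{4(u^2-9)(u^2-1)u^2}{(u^4-9)^2},\quad b=\frac{(u^4-2u^2+9)(u^2+3)^2}{4(u^2-3)^2u^2},\quad c=\frac{(u^8+46u^4+81)(u^2+9)(u^2+1)}{4(u^4-9)^2u^2}.$$ Then $a=s^2-r^2$, $b=\frac{r^4-1}{a}$, $c=\frac{s^4-1}{a}$, and $(a,b,c)$ is a quartic Diophantine triple.
   Context: A quartic Diophantine triple is a triple $(a,b,c)$ of distinct nonzero rational numbers such that $ab+1$, $ac+1$ and $bc+1$ are all fourth powers of rational numbers. -}

module Defs where

open import Data.Rational using (ℚ; 0ℚ; 1ℚ; _+_; _*_; _-_; -_; _÷_; _≟_; ≢-nonZero)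
open import Data.Nat using (ℕ; zero; suc)
open import Data.Product using (∃; _×_)
open import Relation.Binary.PropositionalEquality using (_≡_; _≢_)
open import Relation.Nullary using (yes; no)

-- Total division on ℚ with the convention p / 0 = 0 (all uses in the
-- statement have denominators that are nonzero under the hypotheses).
infixl 7 _⊘_
_⊘_ : ℚ → ℚ → ℚ
p ⊘ q with q ≟ 0ℚ
... | yes _ = 0ℚ
... | no q≢0 = _÷_ p q {{≢-nonZero q≢0}}

infixr 8 _^_
_^_ : ℚ → ℕ → ℚ
p ^ zero = 1ℚ
p ^ suc n = p * (p ^ n)

IsFourthPower : ℚ → Set
IsFourthPower x = ∃ λ t → x ≡ t ^ 4

QuarticDiophantineTriple : ℚ → ℚ → ℚ → Set
QuarticDiophantineTriple a b c =
  a ≢ 0ℚ × b ≢ 0ℚ × c ≢ 0ℚ ×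
  a ≢ b × a ≢ c × b ≢ c ×
  IsFourthPower (a * b + 1ℚ) × IsFourthPower (a * c + 1ℚ) × IsFourthPower (b * c + 1ℚ)

k1 k2 k3 k4 k8 k9 k46 k81 : ℚ
k1 = 1ℚ
k2 = 1ℚ + 1ℚ
k3 = k2 + 1ℚ
k4 = k2 * k2
k8 = k4 * k2
k9 = k3 * k3
k46 = k9 * k4 + k8 + k2
k81 = k9 * k9

rOf sOf : ℚ → ℚ
rOf u = (k2 * u) ⊘ (k3 - u ^ 2)
sOf u = (k8 * u ^ 2) ⊘ (u ^ 4 - k9)

aOf : ℚ → ℚ
aOf u = - ((k4 * (u ^ 2 - k9) * (u ^ 2 - k1) * u ^ 2) ⊘ ((u ^ 4 - k9) ^ 2))

bOf : ℚ → ℚ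
bOf u = ((u ^ 4 - k2 * u ^ 2 + k9) * (u ^ 2 + k3) ^ 2) ⊘ (k4 * (u ^ 2 - k3) ^ 2 * u ^ 2)

cOf : ℚ → ℚ
cOf u = ((u ^ 8 + k46 * u ^ 4 + k81) * (u ^ 2 + k9) * (u ^ 2 + k1)) ⊘ (k4 * (u ^ 4 - k9) ^ 2 * u ^ 2)

-- Each of r, s, a, b, c and t = (u⁴ + 2u² + 9) / (2u(u² − 3)) is a quotient of
-- polynomials in u, so every claim becomes a polynomial identity once the
-- denominators are cleared.  Since b = (r⁴ − 1)/a and c = (s⁴ − 1)/a, the numbers
-- ab + 1 = r⁴ and ac + 1 = s⁴ are fourth powers by construction, and bc + 1 = t⁴
-- is the one genuinely new identity.  The denominators 3 − u² and u⁴ − 9 never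
-- vanish because 3 is not the square of a rational, a ≠ 0 needs u ∉ {0, ±1, ±3},
-- and b, c, b − a, c − a, c − b are nonzero because their cleared numerators are
-- positive combinations of squares.

module Submission where

open import Defs
open import Data.Rational using (ℚ; 0ℚ; 1ℚ; _+_; _*_; _-_; -_)
open import Data.Product using (_×_)
open import Relation.Binary.PropositionalEquality using (_≡_; _≢_)

open import Data.Integer.Base as ℤ using (+_)
open import Data.Integer.Properties using (abs-*)
open import Data.List.Base using (List; []; _∷_)
open import Data.Nat.Base as ℕ using (ℕ; suc)
import Data.Nat.Properties as ℕₚ
open import Algebra.Properties.CommutativeSemigroup ℕₚ.*-commutativeSemigroup using (x∙yz≈y∙xz)
open import Data.Nat.Coprimality using (Coprime; recompute)
open import Data.Nat.Divisibility using (_∣_; divides)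
open import Data.Nat.Primality using (Prime; prime?; euclidsLemma; ¬prime[1]; prime⇒nonZero)
open import Data.Product using (_,_)
open import Data.Rational.Base using (NonZero; _≤_; _<_; 1/_; mkℚ; ≢-nonZero; nonNegative; nonPositive)
import Data.Rational.Properties as ℚ
open import Algebra.Properties.Group ℚ.+-0-group using (x∙y⁻¹≈ε⇒x≈y; inverseˡ-unique)
open import Data.Rational.Literals using (fromℤ)
open import Data.Rational.Solver using (module +-*-Solver)
open import Data.Rational.Unnormalised.Base using (*≡*)
import Data.Rational.Unnormalised.Properties as ℚᵘ
open import Data.Sum.Base using (inj₁; inj₂; reduce)
open import Data.Unit.Base using (tt)
open import Relation.Binary.PropositionalEquality using (refl; sym; trans; cong; cong₂; subst; ≢-sym; module ≡-Reasoning)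
open import Relation.Nullary.Decidable using (yes; no; toWitness)
open import Relation.Nullary.Negation using (contradiction)

open +-*-Solver
open ≡-Reasoning

p*q*1/q≡p : ∀ p q .{{_ : NonZero q}} → p * q * 1/ q ≡ p
p*q*1/q≡p p q = trans (ℚ.*-assoc p q (1/ q)) (trans (cong (p *_) (ℚ.*-inverseʳ q)) (ℚ.*-identityʳ p))

*-cancelʳ-≡ : ∀ p q {r} → r ≢ 0ℚ → p * r ≡ q * r → p ≡ q
*-cancelʳ-≡ p q {r} r≢0 eq = begin
  p              ≡⟨ p*q*1/q≡p p r ⟨
  p * r * 1/ r   ≡⟨ cong (_* 1/ r) eq ⟩
  q * r * 1/ r   ≡⟨ p*q*1/q≡p q r ⟩
  q              ∎
  where instance r-nonZero : NonZero r
                 r-nonZero = ≢-nonZero r≢0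

p*q≢0 : ∀ {p q} → p ≢ 0ℚ → q ≢ 0ℚ → p * q ≢ 0ℚ
p*q≢0 {p} {q} p≢0 q≢0 p*q≡0 = p≢0 (*-cancelʳ-≡ p 0ℚ q≢0 (trans p*q≡0 (sym (ℚ.*-zeroˡ q))))

p*q≢0⇒p≢0 : ∀ {p q} → p * q ≢ 0ℚ → p ≢ 0ℚ
p*q≢0⇒p≢0 {q = q} p*q≢0 refl = p*q≢0 (ℚ.*-zeroˡ q)

p^n≢0 : ∀ {p} n → p ≢ 0ℚ → p ^ n ≢ 0ℚ
p^n≢0 ℕ.zero    p≢0 = ℚ.1≢0
p^n≢0 (suc n) p≢0 = p*q≢0 p≢0 (p^n≢0 n p≢0)

-p≢0 : ∀ {p} → p ≢ 0ℚ → - p ≢ 0ℚ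
-p≢0 p≢0 -p≡0 = p≢0 (ℚ.neg-injective -p≡0)

p≢q⇒p-q≢0 : ∀ {p q} → p ≢ q → p - q ≢ 0ℚ
p≢q⇒p-q≢0 {p} {q} p≢q p-q≡0 = p≢q (x∙y⁻¹≈ε⇒x≈y p q p-q≡0)

p≢-q⇒p+q≢0 : ∀ {p q} → p ≢ - q → p + q ≢ 0ℚ
p≢-q⇒p+q≢0 {p} {q} p≢-q p+q≡0 = p≢-q (inverseˡ-unique p q p+q≡0)

p²-q²≢0 : ∀ {p q} → p ≢ q → p ≢ - q → p ^ 2 - q ^ 2 ≢ 0ℚ
p²-q²≢0 {p} {q} p≢q p≢-q = subst (_≢ 0ℚ) (sym (difference-of-squares p q))
                             (p*q≢0 (p≢q⇒p-q≢0 p≢q) (p≢-q⇒p+q≢0 p≢-q))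
  where
  difference-of-squares : ∀ p q → p ^ 2 - q ^ 2 ≡ (p - q) * (p + q)
  difference-of-squares = solve 2 (λ p q → p :^ 2 :- q :^ 2 := (p :- q) :* (p :+ q)) refl

p⊘q*q≡p : ∀ p {q} → q ≢ 0ℚ → (p ⊘ q) * q ≡ p
p⊘q*q≡p p {q} q≢0 with q ℚ.≟ 0ℚ
... | yes q≡0 = contradiction q≡0 q≢0
... | no _    = begin
  p * 1/ q * q    ≡⟨ ℚ.*-assoc p (1/ q) q ⟩
  p * (1/ q * q)  ≡⟨ cong (p *_) (ℚ.*-inverseˡ q) ⟩
  p * 1ℚ          ≡⟨ ℚ.*-identityʳ p ⟩
  p               ∎
  where instance q-nonZero : NonZero q
                 q-nonZero = ≢-nonZero q≢0

p*q≡r⇒p≡r⊘q : ∀ {p q r} → q ≢ 0ℚ → p * q ≡ r → p ≡ r ⊘ q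
p*q≡r⇒p≡r⊘q {p} {q} {r} q≢0 p*q≡r =
  *-cancelʳ-≡ p (r ⊘ q) q≢0 (trans p*q≡r (sym (p⊘q*q≡p r q≢0)))

q*p≡r-1⇒p*q+1≡r : ∀ p q {r} → q * p ≡ r - 1ℚ → p * q + 1ℚ ≡ r
q*p≡r-1⇒p*q+1≡r p q {r} q*p≡r-1 = begin
  p * q + 1ℚ       ≡⟨ cong (_+ 1ℚ) (trans (ℚ.*-comm p q) q*p≡r-1) ⟩
  r - 1ℚ + 1ℚ      ≡⟨ ℚ.+-assoc r (- 1ℚ) 1ℚ ⟩
  r + 0ℚ           ≡⟨ ℚ.+-identityʳ r ⟩
  r                ∎

[q-p]*r≡s⇒p≢q : ∀ {p q} r {s} → (q - p) * r ≡ s → s ≢ 0ℚ → p ≢ q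
[q-p]*r≡s⇒p≢q {p} r [p-p]*r≡s s≢0 refl =
  s≢0 (trans (sym [p-p]*r≡s) (trans (cong (_* r) (ℚ.+-inverseʳ p)) (ℚ.*-zeroˡ r)))

p∣m*m⇒p∣m : ∀ {p} m → Prime p → p ∣ m ℕ.* m → p ∣ m
p∣m*m⇒p∣m m p-prime p∣m*m = reduce (euclidsLemma m m p-prime p∣m*m)

m*m≢p*[n*n] : ∀ {p m n} → Prime p → Coprime m n → m ℕ.* m ≢ p ℕ.* (n ℕ.* n)
m*m≢p*[n*n] {p} {m} {n} p-prime coprime m*m≡p*[n*n]
  with p∣m*m⇒p∣m m p-prime (divides (n ℕ.* n) (trans m*m≡p*[n*n] (ℕₚ.*-comm p (n ℕ.* n))))
... | divides k refl = ¬prime[1] (subst Prime (coprime (divides k refl , p∣n)) p-prime)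
  where
  instance p-nonZero : ℕ.NonZero p
           p-nonZero = prime⇒nonZero p-prime
  n*n≡[k*k]*p : n ℕ.* n ≡ k ℕ.* k ℕ.* p
  n*n≡[k*k]*p = ℕₚ.*-cancelˡ-≡ (n ℕ.* n) (k ℕ.* k ℕ.* p) p (begin
    p ℕ.* (n ℕ.* n)              ≡⟨ m*m≡p*[n*n] ⟨
    k ℕ.* p ℕ.* (k ℕ.* p)        ≡⟨ ℕₚ.*-assoc k p (k ℕ.* p) ⟩
    k ℕ.* (p ℕ.* (k ℕ.* p))      ≡⟨ x∙yz≈y∙xz k p (k ℕ.* p) ⟩
    p ℕ.* (k ℕ.* (k ℕ.* p))      ≡⟨ cong (p ℕ.*_) (ℕₚ.*-assoc k k p) ⟨
    p ℕ.* (k ℕ.* k ℕ.* p)        ∎)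
  p∣n : p ∣ n
  p∣n = p∣m*m⇒p∣m n p-prime (divides (k ℕ.* k) n*n≡[k*k]*p)

q*q≢prime : ∀ {p} → Prime p → ∀ q → q * q ≢ fromℤ (+ p)
q*q≢prime {p} p-prime q@(mkℚ n d coprime) q*q≡p
  with ℚᵘ.≃-trans (ℚᵘ.≃-sym (ℚ.toℚᵘ-homo-* q q)) (ℚ.toℚᵘ-cong q*q≡p)
... | *≡* n*n*1≡p*[d*d] = m*m≢p*[n*n] p-prime (recompute coprime) (begin
  ℤ.∣ n ∣ ℕ.* ℤ.∣ n ∣                        ≡⟨ ℕₚ.*-identityʳ _ ⟨
  ℤ.∣ n ∣ ℕ.* ℤ.∣ n ∣ ℕ.* 1                  ≡⟨ cong (ℕ._* 1) (abs-* n n) ⟨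
  ℤ.∣ n ℤ.* n ∣ ℕ.* 1                        ≡⟨ abs-* (n ℤ.* n) (+ 1) ⟨
  ℤ.∣ n ℤ.* n ℤ.* + 1 ∣                      ≡⟨ cong ℤ.∣_∣ n*n*1≡p*[d*d] ⟩
  ℤ.∣ + p ℤ.* + (suc d ℕ.* suc d) ∣          ≡⟨ abs-* (+ p) (+ (suc d ℕ.* suc d)) ⟩
  p ℕ.* (suc d ℕ.* suc d)                    ∎)

q²≢3 : ∀ q → q ^ 2 ≢ k3
q²≢3 q = subst (_≢ k3) (cong (q *_) (sym (ℚ.*-identityʳ q))) (q*q≢prime prime[3] q)
  where
  prime[3] : Prime 3
  prime[3] = toWitness {a? = prime? 3} tt

0≤p*p : ∀ p → 0ℚ ≤ p * p
0≤p*p p with ℚ.≤-total 0ℚ p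
... | inj₁ 0≤p = ℚ.nonNegative⁻¹ (p * p)
  {{ℚ.nonNeg*nonNeg⇒nonNeg p {{nonNegative 0≤p}} p {{nonNegative 0≤p}}}}
... | inj₂ p≤0 = ℚ.nonNegative⁻¹ (p * p)
  {{ℚ.nonPos*nonPos⇒nonPos p {{nonPositive p≤0}} p {{nonPositive p≤0}}}}

-- Opaque, so that ≡sumOfSquares⇒≢0 reads the weights off an identity by
-- unification instead of unfolding the rational arithmetic.
opaque
  sumOfSquares : List (ℕ × ℚ) → ℚ
  sumOfSquares []              = 0ℚ
  sumOfSquares ((k , w) ∷ kws) = fromℤ (+ k) * (w * w) + sumOfSquares kws

  0≤sumOfSquares : ∀ kws → 0ℚ ≤ sumOfSquares kws
  0≤sumOfSquares []              = ℚ.≤-refl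
  0≤sumOfSquares ((k , w) ∷ kws) = ℚ.+-mono-≤ 0≤k*w² (0≤sumOfSquares kws)
    where
    0≤k*w² : 0ℚ ≤ fromℤ (+ k) * (w * w)
    0≤k*w² = ℚ.nonNegative⁻¹ _ {{ℚ.nonNeg*nonNeg⇒nonNeg (fromℤ (+ k)) (w * w) {{nonNegative (0≤p*p w)}}}}

  ≡sumOfSquares⇒≢0 : ∀ {x k kws} → x ≡ sumOfSquares ((suc k , 1ℚ) ∷ kws) → x ≢ 0ℚ
  ≡sumOfSquares⇒≢0 {k = k} {kws} refl = ≢-sym (ℚ.<⇒≢ (ℚ.+-mono-<-≤ 0<k+1 (0≤sumOfSquares kws)))
    where
    0<k+1 : 0ℚ < fromℤ (+ suc k) * (1ℚ * 1ℚ)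
    0<k+1 = subst (0ℚ <_) (sym (ℚ.*-identityʳ _)) (ℚ.positive⁻¹ (fromℤ (+ suc k)))

sumOfSquaresᴾ : ∀ {n} → List (ℕ × Polynomial n) → Polynomial n
sumOfSquaresᴾ []              = con 0ℚ
sumOfSquaresᴾ ((k , w) ∷ kws) = con (fromℤ (+ k)) :* (w :* w) :+ sumOfSquaresᴾ kws

rNum rDen sNum sDen aNum aDen bNum bDen cNum cDen tNum tDen tOf : ℚ → ℚ
rNum u = k2 * u
rDen u = k3 - u ^ 2
sNum u = k8 * u ^ 2
sDen u = u ^ 4 - k9
aNum u = - (k4 * (u ^ 2 - k9) * (u ^ 2 - k1) * u ^ 2)
aDen u = sDen u ^ 2
bNum u = (u ^ 4 - k2 * u ^ 2 + k9) * (u ^ 2 + k3) ^ 2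
bDen u = k4 * (u ^ 2 - k3) ^ 2 * u ^ 2
cNum u = (u ^ 8 + k46 * u ^ 4 + k81) * (u ^ 2 + k9) * (u ^ 2 + k1)
cDen u = k4 * sDen u ^ 2 * u ^ 2
tNum u = u ^ 4 + k2 * u ^ 2 + k9
tDen u = k2 * u * (u ^ 2 - k3)
tOf u  = tNum u ⊘ tDen u

module _ {n : ℕ} where
  rNumᴾ rDenᴾ sNumᴾ sDenᴾ aNumᴾ aDenᴾ bNumᴾ bDenᴾ cNumᴾ cDenᴾ tNumᴾ tDenᴾ : Polynomial n → Polynomial n
  rNumᴾ u = con k2 :* u
  rDenᴾ u = con k3 :- u :^ 2
  sNumᴾ u = con k8 :* u :^ 2
  sDenᴾ u = u :^ 4 :- con k9
  aNumᴾ u = :- (con k4 :* (u :^ 2 :- con k9) :* (u :^ 2 :- con k1) :* u :^ 2)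
  aDenᴾ u = sDenᴾ u :^ 2
  bNumᴾ u = (u :^ 4 :- con k2 :* u :^ 2 :+ con k9) :* (u :^ 2 :+ con k3) :^ 2
  bDenᴾ u = con k4 :* (u :^ 2 :- con k3) :^ 2 :* u :^ 2
  cNumᴾ u = (u :^ 8 :+ con k46 :* u :^ 4 :+ con k81) :* (u :^ 2 :+ con k9) :* (u :^ 2 :+ con k1)
  cDenᴾ u = con k4 :* sDenᴾ u :^ 2 :* u :^ 2
  tNumᴾ u = u :^ 4 :+ con k2 :* u :^ 2 :+ con k9
  tDenᴾ u = con k2 :* u :* (u :^ 2 :- con k3)

a≡s²-r²-cleared : ∀ u → aNum u * rDen u ^ 2 ≡ sNum u ^ 2 * rDen u ^ 2 - rNum u ^ 2 * aDen u
a≡s²-r²-cleared = solve 1 (λ u → aNumᴾ u :* rDenᴾ u :^ 2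
                                := sNumᴾ u :^ 2 :* rDenᴾ u :^ 2 :- rNumᴾ u :^ 2 :* aDenᴾ u) refl

b*a≡r⁴-1-cleared : ∀ u → bNum u * aNum u * rDen u ^ 2
                         ≡ rNum u ^ 4 * (k4 * u ^ 2 * aDen u) - bDen u * aDen u * rDen u ^ 2
b*a≡r⁴-1-cleared = solve 1 (λ u → bNumᴾ u :* aNumᴾ u :* rDenᴾ u :^ 2
                                 := rNumᴾ u :^ 4 :* (con k4 :* u :^ 2 :* aDenᴾ u)
                                    :- bDenᴾ u :* aDenᴾ u :* rDenᴾ u :^ 2) refl

c*a≡s⁴-1-cleared : ∀ u → cNum u * aNum u ≡ sNum u ^ 4 * (k4 * u ^ 2) - cDen u * aDen u
c*a≡s⁴-1-cleared = solve 1 (λ u → cNumᴾ u :* aNumᴾ u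
                                 := sNumᴾ u :^ 4 :* (con k4 :* u :^ 2) :- cDenᴾ u :* aDenᴾ u) refl

b*c+1≡t⁴-cleared : ∀ u → bNum u * cNum u + bDen u * cDen u ≡ tNum u ^ 4 * (u ^ 2 + k3) ^ 2
b*c+1≡t⁴-cleared = solve 1 (λ u → bNumᴾ u :* cNumᴾ u :+ bDenᴾ u :* cDenᴾ u
                                 := tNumᴾ u :^ 4 :* (u :^ 2 :+ con k3) :^ 2) refl

opaque
  unfolding sumOfSquares

  b-a-cleared : ∀ u → bNum u * (u ^ 2 + k3) ^ 2 - aNum u * (k4 * u ^ 2)
                    ≡ sumOfSquares ((729 , 1ℚ) ∷ (810 , u) ∷ (469 , u ^ 2) ∷ (26 , u ^ 4 - u ^ 2)
                                     ∷ (29 , u ^ 4) ∷ (10 , u ^ 5) ∷ (1 , u ^ 6) ∷ [])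
  b-a-cleared = solve 1 (λ u → bNumᴾ u :* (u :^ 2 :+ con k3) :^ 2 :- aNumᴾ u :* (con k4 :* u :^ 2)
                            := sumOfSquaresᴾ ((729 , con 1ℚ) ∷ (810 , u) ∷ (469 , u :^ 2) ∷ (26 , u :^ 4 :- u :^ 2)
                                              ∷ (29 , u :^ 4) ∷ (10 , u :^ 5) ∷ (1 , u :^ 6) ∷ [])) refl

  c-a-cleared : ∀ u → cNum u - aNum u * (k4 * u ^ 2)
                    ≡ sumOfSquares ((729 , 1ℚ) ∷ (810 , u) ∷ (639 , u ^ 2) ∷ (300 , u ^ 3)
                                     ∷ (71 , u ^ 4) ∷ (10 , u ^ 5) ∷ (1 , u ^ 6) ∷ [])
  c-a-cleared = solve 1 (λ u → cNumᴾ u :- aNumᴾ u :* (con k4 :* u :^ 2)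
                            := sumOfSquaresᴾ ((729 , con 1ℚ) ∷ (810 , u) ∷ (639 , u :^ 2) ∷ (300 , u :^ 3)
                                              ∷ (71 , u :^ 4) ∷ (10 , u :^ 5) ∷ (1 , u :^ 6) ∷ [])) refl

  c-b-cleared : ∀ u → cNum u - bNum u * (u ^ 2 + k3) ^ 2
                    ≡ u ^ 4 * sumOfSquares ((144 , 1ℚ) ∷ (352 , u) ∷ (16 , u ^ 2) ∷ [])
  c-b-cleared = solve 1 (λ u → cNumᴾ u :- bNumᴾ u :* (u :^ 2 :+ con k3) :^ 2
                            := u :^ 4 :* sumOfSquaresᴾ ((144 , con 1ℚ) ∷ (352 , u) ∷ (16 , u :^ 2) ∷ [])) refl

  bNum-sumOfSquares : ∀ u → bNum u ≡ sumOfSquares ((81 , 1ℚ) ∷ (36 , u) ∷ (6 , u ^ 2) ∷ (4 , u ^ 3) ∷ (1 , u ^ 4) ∷ [])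
  bNum-sumOfSquares = solve 1 (λ u → bNumᴾ u
                                  := sumOfSquaresᴾ ((81 , con 1ℚ) ∷ (36 , u) ∷ (6 , u :^ 2) ∷ (4 , u :^ 3)
                                                    ∷ (1 , u :^ 4) ∷ [])) refl

  cNum-sumOfSquares : ∀ u → cNum u
                          ≡ sumOfSquares ((729 , 1ℚ) ∷ (810 , u) ∷ (495 , u ^ 2) ∷ (460 , u ^ 3)
                                           ∷ (55 , u ^ 4) ∷ (10 , u ^ 5) ∷ (1 , u ^ 6) ∷ [])
  cNum-sumOfSquares = solve 1 (λ u → cNumᴾ u
                                  := sumOfSquaresᴾ ((729 , con 1ℚ) ∷ (810 , u) ∷ (495 , u :^ 2) ∷ (460 , u :^ 3)
                                                    ∷ (55 , u :^ 4) ∷ (10 , u :^ 5) ∷ (1 , u :^ 6) ∷ [])) refl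

  sDen-factorisation : ∀ u → sDen u ≡ (u ^ 2 - k3) * sumOfSquares ((3 , 1ℚ) ∷ (1 , u) ∷ [])
  sDen-factorisation = solve 1 (λ u → sDenᴾ u
                                   := (u :^ 2 :- con k3) :* sumOfSquaresᴾ ((3 , con 1ℚ) ∷ (1 , u) ∷ [])) refl

k2≢0 : k2 ≢ 0ℚ
k2≢0 ()

k4≢0 : k4 ≢ 0ℚ
k4≢0 ()

module _ (u : ℚ) where

  private
    a b c r s t : ℚ
    a = aOf u
    b = bOf u
    c = cOf u
    r = rOf u
    s = sOf u
    t = tOf u

  u²-3≢0 : u ^ 2 - k3 ≢ 0ℚ
  u²-3≢0 = p≢q⇒p-q≢0 (q²≢3 u)

  rDen≢0 : rDen u ≢ 0ℚ
  rDen≢0 = p≢q⇒p-q≢0 (≢-sym (q²≢3 u))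

  sDen≢0 : sDen u ≢ 0ℚ
  sDen≢0 = subst (_≢ 0ℚ) (sym (sDen-factorisation u)) (p*q≢0 u²-3≢0 (≡sumOfSquares⇒≢0 refl))

  r*rDen≡rNum : r * rDen u ≡ rNum u
  r*rDen≡rNum = p⊘q*q≡p (rNum u) rDen≢0

  s*sDen≡sNum : s * sDen u ≡ sNum u
  s*sDen≡sNum = p⊘q*q≡p (sNum u) sDen≢0

  a*aDen≡aNum : a * aDen u ≡ aNum u
  a*aDen≡aNum = trans (sym (ℚ.neg-distribˡ-* (-aNum ⊘ aDen u) (aDen u)))
                      (cong -_ (p⊘q*q≡p -aNum (p^n≢0 2 sDen≢0)))
    where
    -aNum : ℚ
    -aNum = k4 * (u ^ 2 - k9) * (u ^ 2 - k1) * u ^ 2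

  a≡s²-r² : a ≡ s ^ 2 - r ^ 2
  a≡s²-r² = *-cancelʳ-≡ a (s ^ 2 - r ^ 2) (p*q≢0 (p^n≢0 2 sDen≢0) (p^n≢0 2 rDen≢0)) (begin
    a * (aDen u * rDen u ^ 2)
      ≡⟨ ℚ.*-assoc a (aDen u) (rDen u ^ 2) ⟨
    a * aDen u * rDen u ^ 2
      ≡⟨ cong (_* rDen u ^ 2) a*aDen≡aNum ⟩
    aNum u * rDen u ^ 2
      ≡⟨ a≡s²-r²-cleared u ⟩
    sNum u ^ 2 * rDen u ^ 2 - rNum u ^ 2 * aDen u
      ≡⟨ cong₂ (λ x y → x ^ 2 * rDen u ^ 2 - y ^ 2 * aDen u) s*sDen≡sNum r*rDen≡rNum ⟨
    (s * sDen u) ^ 2 * rDen u ^ 2 - (r * rDen u) ^ 2 * aDen u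
      ≡⟨ solve 4 (λ s r d₁ d₂ → (s :* d₂) :^ 2 :* d₁ :^ 2 :- (r :* d₁) :^ 2 :* d₂ :^ 2
                             := (s :^ 2 :- r :^ 2) :* (d₂ :^ 2 :* d₁ :^ 2)) refl s r (rDen u) (sDen u) ⟩
    (s ^ 2 - r ^ 2) * (aDen u * rDen u ^ 2)
      ∎)

  a≢0 : u ≢ 0ℚ → u ≢ 1ℚ → u ≢ - 1ℚ → u ≢ k3 → u ≢ - k3 → a ≢ 0ℚ
  a≢0 u≢0 u≢1 u≢-1 u≢3 u≢-3 = p*q≢0⇒p≢0 (subst (_≢ 0ℚ) (sym a*aDen≡aNum) aNum≢0)
    where
    aNum≢0 : aNum u ≢ 0ℚ
    aNum≢0 = -p≢0 (p*q≢0 (p*q≢0 (p*q≢0 k4≢0 (p²-q²≢0 u≢3 u≢-3)) (p²-q²≢0 u≢1 u≢-1)) (p^n≢0 2 u≢0))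

  module _ (u≢0 : u ≢ 0ℚ) where

    bDen≢0 : bDen u ≢ 0ℚ
    bDen≢0 = p*q≢0 (p*q≢0 k4≢0 (p^n≢0 2 u²-3≢0)) (p^n≢0 2 u≢0)

    cDen≢0 : cDen u ≢ 0ℚ
    cDen≢0 = p*q≢0 (p*q≢0 k4≢0 (p^n≢0 2 sDen≢0)) (p^n≢0 2 u≢0)

    tDen≢0 : tDen u ≢ 0ℚ
    tDen≢0 = p*q≢0 (p*q≢0 k2≢0 u≢0) u²-3≢0

    b*bDen≡bNum : b * bDen u ≡ bNum u
    b*bDen≡bNum = p⊘q*q≡p (bNum u) bDen≢0

    c*cDen≡cNum : c * cDen u ≡ cNum u
    c*cDen≡cNum = p⊘q*q≡p (cNum u) cDen≢0

    t*tDen≡tNum : t * tDen u ≡ tNum u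
    t*tDen≡tNum = p⊘q*q≡p (tNum u) tDen≢0

    b≢0 : b ≢ 0ℚ
    b≢0 = p*q≢0⇒p≢0 (≡sumOfSquares⇒≢0 (trans b*bDen≡bNum (bNum-sumOfSquares u)))

    c≢0 : c ≢ 0ℚ
    c≢0 = p*q≢0⇒p≢0 (≡sumOfSquares⇒≢0 (trans c*cDen≡cNum (cNum-sumOfSquares u)))

    b*a≡r⁴-1 : b * a ≡ r ^ 4 - 1ℚ
    b*a≡r⁴-1 = *-cancelʳ-≡ (b * a) (r ^ 4 - 1ℚ) (p*q≢0 (p*q≢0 bDen≢0 (p^n≢0 2 sDen≢0)) (p^n≢0 2 rDen≢0)) (begin
      b * a * (bDen u * aDen u * rDen u ^ 2)
        ≡⟨ solve 5 (λ b a x y z → b :* a :* (x :* y :* z) := b :* x :* (a :* y) :* z)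
                   refl b a (bDen u) (aDen u) (rDen u ^ 2) ⟩
      b * bDen u * (a * aDen u) * rDen u ^ 2
        ≡⟨ cong₂ (λ x y → x * y * rDen u ^ 2) b*bDen≡bNum a*aDen≡aNum ⟩
      bNum u * aNum u * rDen u ^ 2
        ≡⟨ b*a≡r⁴-1-cleared u ⟩
      rNum u ^ 4 * (k4 * u ^ 2 * aDen u) - bDen u * aDen u * rDen u ^ 2
        ≡⟨ cong (λ x → x ^ 4 * (k4 * u ^ 2 * aDen u) - bDen u * aDen u * rDen u ^ 2) r*rDen≡rNum ⟨
      (r * rDen u) ^ 4 * (k4 * u ^ 2 * aDen u) - bDen u * aDen u * rDen u ^ 2
        ≡⟨ solve 3 (λ u r d → (r :* rDenᴾ u) :^ 4 :* (con k4 :* u :^ 2 :* d) :- bDenᴾ u :* d :* rDenᴾ u :^ 2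
                            := (r :^ 4 :- con 1ℚ) :* (bDenᴾ u :* d :* rDenᴾ u :^ 2)) refl u r (aDen u) ⟩
      (r ^ 4 - 1ℚ) * (bDen u * aDen u * rDen u ^ 2)
        ∎)

    c*a≡s⁴-1 : c * a ≡ s ^ 4 - 1ℚ
    c*a≡s⁴-1 = *-cancelʳ-≡ (c * a) (s ^ 4 - 1ℚ) (p*q≢0 cDen≢0 (p^n≢0 2 sDen≢0)) (begin
      c * a * (cDen u * aDen u)
        ≡⟨ solve 4 (λ c a x y → c :* a :* (x :* y) := c :* x :* (a :* y)) refl c a (cDen u) (aDen u) ⟩
      c * cDen u * (a * aDen u)
        ≡⟨ cong₂ _*_ c*cDen≡cNum a*aDen≡aNum ⟩
      cNum u * aNum u
        ≡⟨ c*a≡s⁴-1-cleared u ⟩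
      sNum u ^ 4 * (k4 * u ^ 2) - cDen u * aDen u
        ≡⟨ cong (λ x → x ^ 4 * (k4 * u ^ 2) - cDen u * aDen u) s*sDen≡sNum ⟨
      (s * sDen u) ^ 4 * (k4 * u ^ 2) - cDen u * aDen u
        ≡⟨ solve 3 (λ u s d → (s :* d) :^ 4 :* (con k4 :* u :^ 2) :- con k4 :* d :^ 2 :* u :^ 2 :* d :^ 2
                            := (s :^ 4 :- con 1ℚ) :* (con k4 :* d :^ 2 :* u :^ 2 :* d :^ 2)) refl u s (sDen u) ⟩
      (s ^ 4 - 1ℚ) * (cDen u * aDen u)
        ∎)

    b*c+1≡t⁴ : b * c + 1ℚ ≡ t ^ 4
    b*c+1≡t⁴ = *-cancelʳ-≡ (b * c + 1ℚ) (t ^ 4) (p*q≢0 bDen≢0 cDen≢0) (begin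
      (b * c + 1ℚ) * (bDen u * cDen u)
        ≡⟨ solve 4 (λ b c x y → (b :* c :+ con 1ℚ) :* (x :* y) := b :* x :* (c :* y) :+ x :* y)
                   refl b c (bDen u) (cDen u) ⟩
      b * bDen u * (c * cDen u) + bDen u * cDen u
        ≡⟨ cong₂ (λ x y → x * y + bDen u * cDen u) b*bDen≡bNum c*cDen≡cNum ⟩
      bNum u * cNum u + bDen u * cDen u
        ≡⟨ b*c+1≡t⁴-cleared u ⟩
      tNum u ^ 4 * (u ^ 2 + k3) ^ 2
        ≡⟨ cong (λ x → x ^ 4 * (u ^ 2 + k3) ^ 2) t*tDen≡tNum ⟨
      (t * tDen u) ^ 4 * (u ^ 2 + k3) ^ 2
        ≡⟨ solve 2 (λ u t → (t :* tDenᴾ u) :^ 4 :* (u :^ 2 :+ con k3) :^ 2 := t :^ 4 :* (bDenᴾ u :* cDenᴾ u))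
                   refl u t ⟩
      t ^ 4 * (bDen u * cDen u)
        ∎)

    a*b+1≡r⁴ : a * b + 1ℚ ≡ r ^ 4
    a*b+1≡r⁴ = q*p≡r-1⇒p*q+1≡r a b b*a≡r⁴-1

    a*c+1≡s⁴ : a * c + 1ℚ ≡ s ^ 4
    a*c+1≡s⁴ = q*p≡r-1⇒p*q+1≡r a c c*a≡s⁴-1

    a≢b : a ≢ b
    a≢b = [q-p]*r≡s⇒p≢q (k4 * u ^ 2 * aDen u) (trans (begin
      (b - a) * (k4 * u ^ 2 * aDen u)
        ≡⟨ solve 3 (λ u a b → (b :- a) :* (con k4 :* u :^ 2 :* aDenᴾ u)
                            := b :* bDenᴾ u :* (u :^ 2 :+ con k3) :^ 2 :- a :* aDenᴾ u :* (con k4 :* u :^ 2))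
                   refl u a b ⟩
      b * bDen u * (u ^ 2 + k3) ^ 2 - a * aDen u * (k4 * u ^ 2)
        ≡⟨ cong₂ (λ x y → x * (u ^ 2 + k3) ^ 2 - y * (k4 * u ^ 2)) b*bDen≡bNum a*aDen≡aNum ⟩
      bNum u * (u ^ 2 + k3) ^ 2 - aNum u * (k4 * u ^ 2)
        ∎) (b-a-cleared u)) (≡sumOfSquares⇒≢0 refl)

    a≢c : a ≢ c
    a≢c = [q-p]*r≡s⇒p≢q (cDen u) (trans (begin
      (c - a) * cDen u
        ≡⟨ solve 3 (λ u a c → (c :- a) :* cDenᴾ u := c :* cDenᴾ u :- a :* aDenᴾ u :* (con k4 :* u :^ 2))
                   refl u a c ⟩
      c * cDen u - a * aDen u * (k4 * u ^ 2)
        ≡⟨ cong₂ (λ x y → x - y * (k4 * u ^ 2)) c*cDen≡cNum a*aDen≡aNum ⟩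
      cNum u - aNum u * (k4 * u ^ 2)
        ∎) (c-a-cleared u)) (≡sumOfSquares⇒≢0 refl)

    b≢c : b ≢ c
    b≢c = [q-p]*r≡s⇒p≢q (cDen u) (trans (begin
      (c - b) * cDen u
        ≡⟨ solve 3 (λ u b c → (c :- b) :* cDenᴾ u := c :* cDenᴾ u :- b :* bDenᴾ u :* (u :^ 2 :+ con k3) :^ 2)
                   refl u b c ⟩
      c * cDen u - b * bDen u * (u ^ 2 + k3) ^ 2
        ≡⟨ cong₂ (λ x y → x - y * (u ^ 2 + k3) ^ 2) c*cDen≡cNum b*bDen≡bNum ⟩
      cNum u - bNum u * (u ^ 2 + k3) ^ 2
        ∎) (c-b-cleared u)) (p*q≢0 (p^n≢0 4 u≢0) (≡sumOfSquares⇒≢0 refl))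

mainTheorem7 : (u : ℚ) → u ≢ 0ℚ → u ≢ 1ℚ → u ≢ - 1ℚ → u ≢ k3 → u ≢ - k3 →
    (aOf u ≡ sOf u ^ 2 - rOf u ^ 2) ×
    (bOf u ≡ (rOf u ^ 4 - 1ℚ) ⊘ aOf u) ×
    (cOf u ≡ (sOf u ^ 4 - 1ℚ) ⊘ aOf u) ×
    QuarticDiophantineTriple (aOf u) (bOf u) (cOf u)
mainTheorem7 u u≢0 u≢1 u≢-1 u≢3 u≢-3 =
    a≡s²-r² u
  , p*q≡r⇒p≡r⊘q a≢0ᵤ (b*a≡r⁴-1 u u≢0)
  , p*q≡r⇒p≡r⊘q a≢0ᵤ (c*a≡s⁴-1 u u≢0)
  , a≢0ᵤ , b≢0 u u≢0 , c≢0 u u≢0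
  , a≢b u u≢0 , a≢c u u≢0 , b≢c u u≢0
  , (rOf u , a*b+1≡r⁴ u u≢0)
  , (sOf u , a*c+1≡s⁴ u u≢0)
  , (tOf u , b*c+1≡t⁴ u u≢0)
  where
  a≢0ᵤ : aOf u ≢ 0ℚ
  a≢0ᵤ = a≢0 u u≢0 u≢1 u≢-1 u≢3 u≢-3
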